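{- Let $d$ be a cardinal with $2\le d\le\omega$, $\mathcal X$ a set, and $\mathcal T\subseteq\mathcal X^d$ finite. Then the following are equivalent: (a) $\mathcal T$ is one-sided and almost acyclic; (b) for each $\vec x^0\in\mathcal T$ there are a positive integer $\mathcal L<d+2$ and a partition $(M_j)_{j\in\mathcal L}$ of $\mathcal T\setminus\{\vec x^0\}$ (into pairwise disjoint, possibly empty, sets indexed by $j\in\{0,\dots,\mathcal L-1\}$) such that (1) for all $i\in d$ and all $j\neq k$ in $\mathcal L$, $\Pi_i[M_j]\cap\Pi_i[M_k]=\emptyset$; (2) for all $i\in d$, $j\in\mathcal L$ and $\vec x\in M_j$, if $x_i=x^0_i$ then $i=j$.
   Context: Elements of $\mathcal X^d$ are written $\vec x=(x_i)_{i\in d}$ and $\Pi_i$ is the $i$-th projection. $G^{\mathcal T}$ is the graph with vertex set $\mathcal T$ and edges $\{\vec x,\vec y\}\subseteq\mathcal T$ with $\vec x\neq\vec y$ and $x_i=y_i$ for some $i\in d$. $\mathcal T$ is one-sided if for all distinct $\vec x,\vec y\in\mathcal T$ and all distinct $i,j\in d$, $x_i\neq y_i$ or $x_j\neq y_j$. $\mathcal T$ is almost acyclic if for every $G^{\mathcal T}$-cycle $(\vec x^n)_{n\le L}$ (in the usual graph-theoretic sense) there are $i\in d$ and $k<m<n<L$ with $x^k_i=x^m_i=x^n_i$. -}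

module Defs where

open import Data.Nat using (ℕ; zero; suc; _+_; _≤_; _<_)
open import Data.Fin using (Fin; toℕ)
open import Data.Unit using (⊤)
open import Data.Product using (Σ; ∃; _×_)
open import Data.Sum using (_⊎_)
open import Relation.Binary.PropositionalEquality using (_≡_; _≢_)

-- A cardinal d with d ≤ ω: either a finite n or ω.
data Card : Set where
  fin : ℕ → Card
  ω   : Card

-- The index set d = {i | i < d} (von Neumann ordinal).
Idx : Card → Set
Idx (fin n) = Fin n
Idx ω       = ℕ

-- the index as a natural number (used to compare i ∈ d with j ∈ L)
idx→ℕ : ∀ {d} → Idx d → ℕ
idx→ℕ {fin n} i = toℕ i
idx→ℕ {ω}     i = i

TwoLe : Card → Set
TwoLe (fin n) = 2 ≤ n
TwoLe ω       = ⊤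

LtPlus2 : ℕ → Card → Set
LtPlus2 L (fin n) = L < n + 2
LtPlus2 L ω       = ⊤

Tuple : Card → Set → Set
Tuple d X = Idx d → X

-- A finite set T ⊆ X^d with m elements is given by an injective
-- enumeration T : Fin m → X^d (injective w.r.t. pointwise equality of tuples).
InjectiveFam : ∀ {d X m} → (Fin m → Tuple d X) → Set
InjectiveFam {d} {X} {m} T = ∀ (a b : Fin m) → (∀ (i : Idx d) → T a i ≡ T b i) → a ≡ b

module _ {d : Card} {X : Set} {m : ℕ} (T : Fin m → Tuple d X) where

  Adj : Fin m → Fin m → Set
  Adj a b = a ≢ b × Σ (Idx d) (λ i → T a i ≡ T b i)

  OneSided : Set
  OneSided = ∀ (a b : Fin m) → a ≢ b → ∀ (i j : Idx d) → i ≢ j →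
             (T a i ≢ T b i) ⊎ (T a j ≢ T b j)

  IsCycle : ℕ → (ℕ → Fin m) → Set
  IsCycle L c =
      3 ≤ L
    × c L ≡ c 0
    × (∀ n → n < L → Adj (c n) (c (suc n)))
    × (∀ k n → k < L → n < L → c k ≡ c n → k ≡ n)

  AlmostAcyclic : Set
  AlmostAcyclic = ∀ (L : ℕ) (c : ℕ → Fin m) → IsCycle L c →
    Σ (Idx d) λ i → ∃ λ k → ∃ λ l → ∃ λ n →
      k < l × l < n × n < L × T (c k) i ≡ T (c l) i × T (c l) i ≡ T (c n) i

  -- A partition (M_j)_{j ∈ L} of T ∖ {x0} (possibly empty parts) is encoded
  -- by the labelling lab : T ∖ {x0} → L, with M_j = {a | lab a ≡ j}.
  GoodPartition : (x0 : Fin m) (L : ℕ) → ((a : Fin m) → a ≢ x0 → Fin L) → Set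
  GoodPartition x0 L lab =
      (∀ (i : Idx d) (a b : Fin m) (ha : a ≢ x0) (hb : b ≢ x0) →
         lab a ha ≢ lab b hb → T a i ≢ T b i)
    × (∀ (i : Idx d) (a : Fin m) (ha : a ≢ x0) →
         T a i ≡ T x0 i → idx→ℕ i ≡ toℕ (lab a ha))

  ConditionB : Set
  ConditionB = ∀ (x0 : Fin m) → Σ ℕ λ L →
      1 ≤ L × LtPlus2 L d
    × Σ ((a : Fin m) → a ≢ x0 → Fin L) (GoodPartition x0 L)

module Submission where

-- Fix x0 ∈ T and look at the graph G^T with x0 removed.
-- (a) ⇒ (b): label each component of that graph by the coordinate i in
--   which one of its vertices meets x0 (label 0 if there is none), and let
--   M_j be the vertices labelled j.  Vertices sharing a coordinate lie in one
--   component, which gives (1); (2) holds because a component meets x0 in at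
--   most one coordinate.  The latter is the heart of the proof: a walk
--   avoiding x0 from a vertex meeting x0 at coordinate i to one meeting it at
--   j ≠ i (a "crossing") cannot exist.  Every crossing can be shortened
--   (through a vertex meeting x0 inside it, a chord, or a repeated vertex)
--   unless it is chordless, and a chordless crossing closed up through x0 is
--   a G^T-cycle whose coordinate triples contradict almost acyclicity (the
--   shortest crossing, of length 0, contradicts one-sidedness).
-- (b) ⇒ (a): for a cycle through x0 all other vertices lie in a single part,
--   so by (2) x0 meets its two neighbours on the cycle in the same coordinate;
--   one-sidedness is (2) applied at x0 := one of the two tuples.

open import Defs
open import Level using (0ℓ)
open import Data.Nat using (ℕ; zero; suc; _+_; _∸_; _≤_; _<_; _⊔_; _≤?_; z≤n; s≤s; z<s; s<s)
open import Data.Nat.Properties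
open import Data.Nat.Induction using (<-rec)
open import Data.Fin as Fin using (Fin; toℕ; fromℕ<)
import Data.Fin.Properties as Finₚ
open import Data.Unit using (tt)
open import Data.Product using (Σ; ∃; _×_; _,_; proj₁; proj₂)
open import Data.Sum using (_⊎_; inj₁; inj₂)
open import Data.Empty using (⊥; ⊥-elim)
open import Function using (_∘_)
open import Relation.Nullary using (¬_; Dec; yes; no)
open import Relation.Binary using (tri<; tri≈; tri>)
open import Relation.Binary.Definitions using (DecidableEquality)
open import Relation.Binary.PropositionalEquality
open import Function.Bundles using (_⇔_; mk⇔)
open import Axiom.ExcludedMiddle using (ExcludedMiddle)

idx-≟ : ∀ {d} → DecidableEquality (Idx d)
idx-≟ {fin n} = Finₚ._≟_
idx-≟ {ω}     = _≟_

idx→ℕ-injective : ∀ {d} {i j : Idx d} → idx→ℕ i ≡ idx→ℕ j → i ≡ j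
idx→ℕ-injective {fin n} = Finₚ.toℕ-injective
idx→ℕ-injective {ω}     = λ e → e

module Walks {d : Card} {X : Set} {m : ℕ} (T : Fin m → Tuple d X) (x0 : Fin m) where

  private variable
    a b c : Fin m
    K K₁ K₂ : ℕ

  Share : Fin m → Fin m → Set
  Share a b = Σ (Idx d) λ l → T a l ≡ T b l

  share-sym : Share a b → Share b a
  share-sym (l , e) = l , sym e

  Touches : Fin m → Idx d → Set
  Touches a l = T a l ≡ T x0 l

  -- a walk of length K from a to b whose vertices all differ from x0
  -- (consecutive vertices share a coordinate but may coincide)
  record Walk (a b : Fin m) (K : ℕ) : Set where
    field
      vertex : ℕ → Fin m
      start  : vertex 0 ≡ a
      finish : vertex K ≡ b
      linked : ∀ n → n < K → Share (vertex n) (vertex (suc n))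
      avoids : ∀ n → n ≤ K → vertex n ≢ x0
  open Walk public

  first-avoids : Walk a b K → a ≢ x0
  first-avoids w = subst (_≢ x0) (start w) (avoids w 0 z≤n)

  stays : Walk a b 0 → a ≡ b
  stays w = trans (sym (start w)) (finish w)

  stay : a ≢ x0 → Walk a a 0
  stay {a} a≢x0 = record
    { vertex = λ _ → a ; start = refl ; finish = refl
    ; linked = λ _ () ; avoids = λ _ _ → a≢x0 }

  cons : Share a b → a ≢ x0 → Walk b c K → Walk a c (suc K)
  cons {a} {b} {c} {K} sh a≢x0 w = record
    { vertex = v ; start = refl ; finish = finish w ; linked = lk ; avoids = av }
    where
    v : ℕ → Fin m
    v zero    = a
    v (suc n) = vertex w n
    lk : ∀ n → n < suc K → Share (v n) (v (suc n))
    lk zero    _           = subst (Share a) (sym (start w)) sh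
    lk (suc n) (s<s n<K)   = linked w n n<K
    av : ∀ n → n ≤ suc K → v n ≢ x0
    av zero    _           = a≢x0
    av (suc n) (s≤s n≤K)   = avoids w n n≤K

  edge : Share a b → a ≢ x0 → b ≢ x0 → Walk a b 1
  edge sh a≢x0 b≢x0 = cons sh a≢x0 (stay b≢x0)

  tail : (w : Walk a b (suc K)) → Walk (vertex w 1) b K
  tail w = record
    { vertex = vertex w ∘ suc ; start = refl ; finish = finish w
    ; linked = λ n n<K → linked w (suc n) (s<s n<K)
    ; avoids = λ n n≤K → avoids w (suc n) (s≤s n≤K) }

  concat : Walk a b K₁ → Walk b c K₂ → Walk a c (K₁ + K₂)
  concat {K₁ = zero}   w w′ = subst (λ z → Walk z _ _) (sym (stays w)) w′
  concat {K₁ = suc K₁} w w′ =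
    cons (subst (λ z → Share z (vertex w 1)) (start w) (linked w 0 z<s))
         (first-avoids w) (concat (tail w) w′)

  reverse : Walk a b K → Walk b a K
  reverse {a} {b} {K} w = record
    { vertex = λ n → vertex w (K ∸ n)
    ; start  = finish w
    ; finish = trans (cong (vertex w) (n∸n≡0 K)) (start w)
    ; linked = backwards
    ; avoids = λ n _ → avoids w (K ∸ n) (m∸n≤m K n) }
    where
    backwards : ∀ n → n < K → Share (vertex w (K ∸ n)) (vertex w (K ∸ suc n))
    backwards n n<K = share-sym (subst (λ z → Share (vertex w (K ∸ suc n)) (vertex w z))
                                       (sym K∸n≡) (linked w (K ∸ suc n) bound))
      where
      K∸n≡ : K ∸ n ≡ suc (K ∸ suc n)
      K∸n≡ = +-∸-assoc 1 n<K
      bound : K ∸ suc n < K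
      bound = subst (_≤ K) K∸n≡ (m∸n≤m K n)

  reindex : K₁ ≡ K₂ → (w : Walk a b K₁) → Walk a b K₂
  reindex {b = b} K₁≡K₂ w = record
    { vertex = vertex w ; start = start w
    ; finish = subst (λ k → vertex w k ≡ b) K₁≡K₂ (finish w)
    ; linked = λ n h → linked w n (subst (n <_) (sym K₁≡K₂) h)
    ; avoids = λ n h → avoids w n (subst (n ≤_) (sym K₁≡K₂) h) }

  suffix : ∀ t → (w : Walk a b (t + K)) → Walk (vertex w t) b K
  suffix zero    w = record
    { vertex = vertex w ; start = refl ; finish = finish w
    ; linked = linked w ; avoids = avoids w }
  suffix (suc t) w = suffix t (tail w)

  take : ∀ t → t ≤ K → (w : Walk a b K) → Walk a (vertex w t) t
  take t t≤K w = record
    { vertex = vertex w ; start = start w ; finish = refl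
    ; linked = λ n n<t → linked w n (<-≤-trans n<t t≤K)
    ; avoids = λ n n≤t → avoids w n (≤-trans n≤t t≤K) }

  drop : ∀ t → t ≤ K → (w : Walk a b K) → Walk (vertex w t) b (K ∸ t)
  drop t t≤K w = suffix t (reindex (sym (m+[n∸m]≡n t≤K)) w)

  Connected : Fin m → Fin m → Set
  Connected a b = ∃ (Walk a b)

-- In a one-sided, almost acyclic T no walk avoiding x0 joins a vertex
-- meeting x0 at coordinate i to one meeting it at a coordinate j ≠ i.

module Crossings (em : ExcludedMiddle 0ℓ) {d : Card} {X : Set} {m : ℕ}
                 {T : Fin m → Tuple d X} (one-sided : OneSided T)
                 (almost-acyclic : AlmostAcyclic T) (x0 : Fin m) where

  open Walks T x0

  private variable
    a b : Fin m
    i j : Idx d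
    K : ℕ

  touch-unique : a ≢ x0 → Touches a i → Touches a j → i ≡ j
  touch-unique {a} {i} {j} a≢x0 ti tj with idx-≟ i j
  ... | yes i≡j = i≡j
  ... | no i≢j with one-sided a x0 a≢x0 i j i≢j
  ...   | inj₁ ¬ti = ⊥-elim (¬ti ti)
  ...   | inj₂ ¬tj = ⊥-elim (¬tj tj)

  data Crossing (K : ℕ) : Set where
    crossing : Walk a b K → i ≢ j → Touches a i → Touches b j → Crossing K

  -- the three ways in which a walk can fail to be chordless
  module _ {a b : Fin m} {K : ℕ} (w : Walk a b K) where

    InteriorTouch : Set
    InteriorTouch = Σ ℕ λ t → Σ (Idx d) λ l → 0 < t × t < K × Touches (vertex w t) l

    Chord : Set
    Chord = Σ ℕ λ s → Σ ℕ λ t → suc s < t × t ≤ K × Share (vertex w s) (vertex w t)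

    Stutter : Set
    Stutter = Σ ℕ λ s → s < K × vertex w s ≡ vertex w (suc s)

  Shorter : ℕ → Set
  Shorter K = ∃ λ K′ → K′ < K × Crossing K′

  module _ {a b : Fin m} {i j : Idx d} {K : ℕ} (w : Walk a b K) (i≢j : i ≢ j)
           (ti : Touches a i) (tj : Touches b j) where

    split-at-touch : InteriorTouch w → Shorter K
    split-at-touch (t , l , 0<t , t<K , tl) with idx-≟ l i
    ... | yes l≡i = K ∸ t , ∸-monoʳ-< 0<t (<⇒≤ t<K) ,
                    crossing (drop t (<⇒≤ t<K) w) i≢j (subst (Touches _) l≡i tl) tj
    ... | no l≢i  = t , t<K , crossing (take t (<⇒≤ t<K) w) (l≢i ∘ sym) ti tl

    skip-chord : Chord w → Shorter K
    skip-chord (s , t , s+1<t , t≤K , sh) =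
      s + suc (K ∸ t) ,
      subst₂ _<_ (sym (+-suc s (K ∸ t))) (m+[n∸m]≡n t≤K) (+-monoˡ-< (K ∸ t) s+1<t) ,
      crossing (concat (take s s≤K w) (cons sh (avoids w s s≤K) (drop t t≤K w))) i≢j ti tj
      where
      s≤K : s ≤ K
      s≤K = ≤-trans (≤-trans (n≤1+n s) (<⇒≤ s+1<t)) t≤K

    skip-stutter : Stutter w → Shorter K
    skip-stutter (s , s<K , vs≡vs+1) =
      s + (K ∸ suc s) ,
      subst (s + (K ∸ suc s) <_) (m+[n∸m]≡n s<K) (+-monoˡ-< (K ∸ suc s) (n<1+n s)) ,
      crossing (concat (take s (<⇒≤ s<K) w)
                       (subst (λ z → Walk z b (K ∸ suc s)) (sym vs≡vs+1) (drop (suc s) s<K w)))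
               i≢j ti tj

  -- A chordless crossing, closed up through x0, is a cycle of G^T on which
  -- no coordinate is shared by three vertices.
  module Chordless {a b : Fin m} {i j : Idx d} {K : ℕ} (w : Walk a b K) (i≢j : i ≢ j)
                   (ti : Touches a i) (tj : Touches b j) (¬touch : ¬ InteriorTouch w)
                   (¬chord : ¬ Chord w) (¬stutter : ¬ Stutter w) where

    touch-first : Touches (vertex w 0) i
    touch-first = subst (λ z → Touches z i) (sym (start w)) ti

    touch-last : Touches (vertex w K) j
    touch-last = subst (λ z → Touches z j) (sym (finish w)) tj

    ends-touch : ∀ t l → t ≤ K → Touches (vertex w t) l → (t ≡ 0 × l ≡ i) ⊎ (t ≡ K × l ≡ j)
    ends-touch zero l _ tl = inj₁ (refl , touch-unique (avoids w 0 z≤n) tl touch-first)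
    ends-touch (suc t) l t+1≤K tl with m≤n⇒m<n∨m≡n t+1≤K
    ... | inj₁ t+1<K = ⊥-elim (¬touch (suc t , l , z<s , t+1<K , tl))
    ... | inj₂ t+1≡K = inj₂ (t+1≡K , touch-unique (avoids w (suc t) t+1≤K) tl
                           (subst (λ k → Touches (vertex w k) j) (sym t+1≡K) touch-last))

    consecutive : ∀ {s t} → s < t → t ≤ K → Share (vertex w s) (vertex w t) → t ≡ suc s
    consecutive {s} {t} s<t t≤K sh with m≤n⇒m<n∨m≡n s<t
    ... | inj₁ s+1<t = ⊥-elim (¬chord (s , t , s+1<t , t≤K , sh))
    ... | inj₂ s+1≡t = sym s+1≡t

    no-repeat : ∀ {s t} → s < t → t ≤ K → vertex w s ≢ vertex w t
    no-repeat {s} s<t t≤K vs≡vt = ¬stutter (s , <-≤-trans s<t t≤K ,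
      trans vs≡vt (cong (vertex w) (consecutive s<t t≤K (i , cong (λ z → T z i) vs≡vt))))

    -- the closed walk x0, w 0, …, w K, x0
    closure : ℕ → Fin m
    closure zero = x0
    closure (suc n) with n ≤? K
    ... | yes _ = vertex w n
    ... | no _  = x0

    closure-inner : ∀ n → n ≤ K → closure (suc n) ≡ vertex w n
    closure-inner n n≤K with n ≤? K
    ... | yes _   = refl
    ... | no n≰K  = ⊥-elim (n≰K n≤K)

    closure-end : closure (suc (suc K)) ≡ x0
    closure-end with suc K ≤? K
    ... | yes K+1≤K = ⊥-elim (<-irrefl refl K+1≤K)
    ... | no _      = refl

    closure-adjacent : ∀ n → n < suc (suc K) → Adj T (closure n) (closure (suc n))
    closure-adjacent zero _ =
      subst (Adj T x0) (sym (closure-inner 0 z≤n))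
            ((λ x0≡ → avoids w 0 z≤n (sym x0≡)) , i , sym touch-first)
    closure-adjacent (suc n) (s<s (s≤s n≤K)) with m≤n⇒m<n∨m≡n n≤K
    ... | inj₁ n<K = subst₂ (Adj T) (sym (closure-inner n n≤K)) (sym (closure-inner (suc n) n<K))
                            (no-repeat (n<1+n n) n<K , linked w n n<K)
    ... | inj₂ n≡K = subst (λ k → Adj T (closure (suc k)) (closure (suc (suc k)))) (sym n≡K)
                           (subst₂ (Adj T) (sym (closure-inner K ≤-refl)) (sym closure-end)
                                   (avoids w K ≤-refl , j , touch-last))

    closure-distinct : ∀ s t → s < suc (suc K) → t < suc (suc K) → closure s ≡ closure t → s ≡ t
    closure-distinct zero    zero    _ _ _ = refl
    closure-distinct zero    (suc t) _ (s<s (s≤s t≤K)) eq =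
      ⊥-elim (avoids w t t≤K (sym (trans eq (closure-inner t t≤K))))
    closure-distinct (suc s) zero    (s<s (s≤s s≤K)) _ eq =
      ⊥-elim (avoids w s s≤K (trans (sym (closure-inner s s≤K)) eq))
    closure-distinct (suc s) (suc t) (s<s (s≤s s≤K)) (s<s (s≤s t≤K)) eq with <-cmp s t
    ... | tri≈ _ s≡t _ = cong suc s≡t
    ... | tri< s<t _ _ = ⊥-elim (no-repeat s<t t≤K vs≡vt)
      where
      vs≡vt : vertex w s ≡ vertex w t
      vs≡vt = trans (sym (closure-inner s s≤K)) (trans eq (closure-inner t t≤K))
    ... | tri> _ _ t<s = ⊥-elim (no-repeat t<s s≤K vt≡vs)
      where
      vt≡vs : vertex w t ≡ vertex w s
      vt≡vs = trans (sym (closure-inner t t≤K)) (trans (sym eq) (closure-inner s s≤K))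

    closure-cycle : 1 ≤ K → IsCycle T (suc (suc K)) closure
    closure-cycle 1≤K = s≤s (s≤s 1≤K) , closure-end , closure-adjacent , closure-distinct

    inner-touch : ∀ n l → n ≤ K → T x0 l ≡ T (closure (suc n)) l → Touches (vertex w n) l
    inner-touch n l n≤K e = sym (trans e (cong (λ z → T z l) (closure-inner n n≤K)))

    no-triple : (Σ (Idx d) λ l → ∃ λ p → ∃ λ q → ∃ λ r →
                   p < q × q < r × r < suc (suc K) ×
                   T (closure p) l ≡ T (closure q) l × T (closure q) l ≡ T (closure r) l) → ⊥
    no-triple (l , zero , suc q , suc r , _ , s<s q<r , s<s (s≤s r≤K) , e₁ , e₂)
      with ends-touch q l q≤K (inner-touch q l q≤K e₁)
         | ends-touch r l r≤K (inner-touch r l r≤K (trans e₁ e₂))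
      where
      q≤K : q ≤ K
      q≤K = <⇒≤ (<-≤-trans q<r r≤K)
    ... | inj₂ (q≡K , _) | _ = <-irrefl refl (<-≤-trans q<r (subst (_ ≤_) (sym q≡K) r≤K))
    ... | inj₁ _ | inj₁ (r≡0 , _) = n≮0 (subst (q <_) r≡0 q<r)
    ... | inj₁ (_ , l≡i) | inj₂ (_ , l≡j) = i≢j (trans (sym l≡i) l≡j)
    no-triple (l , suc p , suc q , suc r , s<s p<q , s<s q<r , s<s (s≤s r≤K) , e₁ , e₂) =
      <-irrefl (sym r≡p+1) (≤-<-trans p<q q<r)
      where
      shares : Share (vertex w p) (vertex w r)
      shares = l , trans (cong (λ z → T z l) (sym (closure-inner p p≤K)))
                         (trans (trans e₁ e₂) (cong (λ z → T z l) (closure-inner r r≤K)))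
        where
        p≤K : p ≤ K
        p≤K = <⇒≤ (<-≤-trans (<-trans p<q q<r) r≤K)
      r≡p+1 : r ≡ suc p
      r≡p+1 = consecutive (<-trans p<q q<r) r≤K shares
    no-triple (_ , _ , zero , _ , () , _)
    no-triple (_ , _ , suc _ , zero , _ , () , _)

    closes : 1 ≤ K → ⊥
    closes 1≤K = no-triple (almost-acyclic _ closure (closure-cycle 1≤K))

  shorter : Crossing K → Shorter K
  shorter {zero} (crossing w i≢j ti tj) =
    ⊥-elim (i≢j (touch-unique (first-avoids w) ti (subst (λ z → Touches z _) (sym (stays w)) tj)))
  shorter {suc K} (crossing w i≢j ti tj)
    with em {InteriorTouch w} | em {Chord w} | em {Stutter w}
  ... | yes touch | _ | _ = split-at-touch w i≢j ti tj touch
  ... | no _ | yes chord | _ = skip-chord w i≢j ti tj chord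
  ... | no _ | no _ | yes stutter = skip-stutter w i≢j ti tj stutter
  ... | no ¬touch | no ¬chord | no ¬stutter =
    ⊥-elim (Chordless.closes w i≢j ti tj ¬touch ¬chord ¬stutter (s≤s z≤n))

  no-crossing : ¬ Crossing K
  no-crossing {K} = <-rec (λ K → ¬ Crossing K) descend K
    where
    descend : ∀ K → (∀ {K′} → K′ < K → ¬ Crossing K′) → ¬ Crossing K
    descend K ih c with shorter c
    ... | K′ , K′<K , c′ = ih K′<K c′

  connected-touch : Connected a b → Touches a i → Touches b j → i ≡ j
  connected-touch {i = i} {j = j} (_ , w) ti tj with idx-≟ i j
  ... | yes i≡j = i≡j
  ... | no i≢j  = ⊥-elim (no-crossing (crossing w i≢j ti tj))

-- (a) ⇒ (b): label the components of G^T with x0 removed.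

finite-bound : ∀ {m} (f : Fin m → ℕ) → ∃ λ B → ∀ a → f a ≤ B
finite-bound {zero}  f = 0 , λ ()
finite-bound {suc m} f with finite-bound (f ∘ Fin.suc)
... | B , f≤B = f Fin.zero ⊔ B , bound
  where
  bound : ∀ a → f a ≤ f Fin.zero ⊔ B
  bound Fin.zero    = m≤m⊔n _ _
  bound (Fin.suc a) = ≤-trans (f≤B a) (m≤n⊔m _ _)

part-count : (d : Card) {m : ℕ} (f : Fin m → ℕ) →
             (∀ a → f a ≡ 0 ⊎ ∃ λ (i : Idx d) → f a ≡ idx→ℕ i) →
             Σ ℕ λ L → 1 ≤ L × LtPlus2 L d × (∀ a → f a < L)
part-count (fin n) f range = suc n , s≤s z≤n , subst (suc n <_) (+-comm 2 n) ≤-refl , below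
  where
  below : ∀ a → f a < suc n
  below a with range a
  ... | inj₁ fa≡0       = subst (_< suc n) (sym fa≡0) z<s
  ... | inj₂ (i , fa≡i) = subst (_< suc n) (sym fa≡i) (m<n⇒m<1+n (Finₚ.toℕ<n i))
part-count ω f _ with finite-bound f
... | B , f≤B = suc B , s≤s z≤n , tt , λ a → s≤s (f≤B a)

module Labelling (em : ExcludedMiddle 0ℓ) {d : Card} {X : Set} {m : ℕ}
                 {T : Fin m → Tuple d X} (one-sided : OneSided T)
                 (almost-acyclic : AlmostAcyclic T) (x0 : Fin m) where

  open Walks T x0
  open Crossings em one-sided almost-acyclic x0 using (connected-touch)

  Meets : Fin m → Set
  Meets a = Σ (Idx d) λ i → Σ (Fin m) λ b → Connected a b × Touches b i

  label : ∀ {a} → Dec (Meets a) → ℕ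
  label (yes (i , _)) = idx→ℕ i
  label (no _)        = 0

  label-range : ∀ {a} (da : Dec (Meets a)) → label da ≡ 0 ⊎ ∃ λ (i : Idx d) → label da ≡ idx→ℕ i
  label-range (yes (i , _)) = inj₂ (i , refl)
  label-range (no _)        = inj₁ refl

  -- vertices sharing a coordinate lie in one component, hence get one label
  label-share : ∀ {a b} → Share a b → a ≢ x0 → b ≢ x0 →
                (da : Dec (Meets a)) (db : Dec (Meets b)) → label da ≡ label db
  label-share sh ha hb (yes (i , a′ , (_ , wa) , ti)) (yes (j , b′ , (_ , wb) , tj)) =
    cong idx→ℕ (connected-touch (_ , concat (reverse wa) (concat (edge sh ha hb) wb)) ti tj)
  label-share sh ha hb (yes (i , a′ , (_ , wa) , ti)) (no ¬mb) =
    ⊥-elim (¬mb (i , a′ , (_ , concat (edge (share-sym sh) hb ha) wa) , ti))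
  label-share sh ha hb (no ¬ma) (yes (j , b′ , (_ , wb) , tj)) =
    ⊥-elim (¬ma (j , b′ , (_ , concat (edge sh ha hb) wb) , tj))
  label-share _ _ _ (no _) (no _) = refl

  label-touch : ∀ {a i} → a ≢ x0 → Touches a i → (da : Dec (Meets a)) → idx→ℕ i ≡ label da
  label-touch ha ti (yes (j , b , conn , tj)) = cong idx→ℕ (connected-touch conn ti tj)
  label-touch {a} {i} ha ti (no ¬ma) = ⊥-elim (¬ma (i , a , (0 , stay ha) , ti))

  labelOf : Fin m → ℕ
  labelOf a = label (em {Meets a})

  good-partition : Σ ℕ λ L → 1 ≤ L × LtPlus2 L d ×
                   Σ ((a : Fin m) → a ≢ x0 → Fin L) (GoodPartition T x0 L)
  good-partition with part-count d labelOf (λ a → label-range (em {Meets a}))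
  ... | L , 1≤L , L<d+2 , labelOf<L = L , 1≤L , L<d+2 , part , disjoint , coordinate
    where
    part : (a : Fin m) → a ≢ x0 → Fin L
    part a _ = fromℕ< (labelOf<L a)
    disjoint : ∀ i a b (ha : a ≢ x0) (hb : b ≢ x0) → part a ha ≢ part b hb → T a i ≢ T b i
    disjoint i a b ha hb parts≢ e =
      parts≢ (Finₚ.fromℕ<-cong _ _ (label-share (i , e) ha hb (em {Meets a}) (em {Meets b})) _ _)
    coordinate : ∀ i a (ha : a ≢ x0) → T a i ≡ T x0 i → idx→ℕ i ≡ toℕ (part a ha)
    coordinate i a ha e = trans (label-touch ha e (em {Meets a})) (sym (Finₚ.toℕ-fromℕ< _))

module FromPartition {d : Card} {X : Set} {m : ℕ} {T : Fin m → Tuple d X} {x0 : Fin m}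
                     {L : ℕ} {part : (a : Fin m) → a ≢ x0 → Fin L}
                     (good : GoodPartition T x0 L part) where

  same-part : ∀ {a b} (ha : a ≢ x0) (hb : b ≢ x0) l → T a l ≡ T b l → part a ha ≡ part b hb
  same-part {a} {b} ha hb l e with part a ha Finₚ.≟ part b hb
  ... | yes same = same
  ... | no differ = ⊥-elim (proj₁ good l a b ha hb differ e)

  part-coordinate : ∀ {a b i j} (ha : a ≢ x0) (hb : b ≢ x0) → part a ha ≡ part b hb →
                    T a i ≡ T x0 i → T b j ≡ T x0 j → i ≡ j
  part-coordinate {a} {b} {i} {j} ha hb same ti tj =
    idx→ℕ-injective (trans (proj₂ good i a ha ti) (trans (cong toℕ same) (sym (proj₂ good j b hb tj))))

module _ {d : Card} {X : Set} {m : ℕ} {T : Fin m → Tuple d X} (cb : ConditionB T) where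

  -- two distinct tuples agreeing in i and j would meet (b) at x0 := a twice
  one-sided-from : ExcludedMiddle 0ℓ → OneSided T
  one-sided-from em a b a≢b i j i≢j with em {T a i ≡ T b i} | cb a
  ... | no ¬ei | _ = inj₁ ¬ei
  ... | yes ei | _ , _ , _ , _ , good =
    inj₂ λ ej → i≢j (part-coordinate b≢a b≢a refl (sym ei) (sym ej))
    where
    open FromPartition good
    b≢a : b ≢ a
    b≢a = λ b≡a → a≢b (sym b≡a)

  -- on a cycle through x0 := c 0 all other vertices lie in one part, so x0
  -- meets both of its neighbours c 1 and c (L-1) in the same coordinate
  almost-acyclic-from : AlmostAcyclic T
  almost-acyclic-from (suc (suc (suc L₀))) c (s≤s (s≤s (s≤s _)) , closed , adjacent , distinct) with cb (c 0)
  ... | _ , _ , _ , part , good =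
    i , 0 , 1 , N , z<s , s<s z<s , ≤-refl , e₁ ,
    trans (sym e₁) (sym (subst (λ l → T (c N) l ≡ T (c 0) l) (sym i≡j) eₙ))
    where
    open FromPartition good
    N : ℕ
    N = suc (suc L₀)
    off-start : ∀ n → suc n < suc N → c (suc n) ≢ c 0
    off-start n h e with distinct (suc n) 0 h z<s e
    ... | ()
    i : Idx d
    i = proj₁ (proj₂ (adjacent 0 z<s))
    e₁ : T (c 0) i ≡ T (c 1) i
    e₁ = proj₂ (proj₂ (adjacent 0 z<s))
    j : Idx d
    j = proj₁ (proj₂ (adjacent N ≤-refl))
    eₙ : T (c N) j ≡ T (c 0) j
    eₙ = trans (proj₂ (proj₂ (adjacent N ≤-refl))) (cong (λ z → T z j) closed)
    one-part : ∀ n (h : suc n < suc N) → part (c (suc n)) (off-start n h) ≡ part (c 1) (off-start 0 (s<s z<s))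
    one-part zero    h = same-part _ _ i refl
    one-part (suc n) h = trans (same-part _ _ l (sym e)) (one-part n h′)
      where
      h′ : suc n < suc N
      h′ = <-trans (n<1+n _) h
      l : Idx d
      l = proj₁ (proj₂ (adjacent (suc n) h′))
      e : T (c (suc n)) l ≡ T (c (suc (suc n))) l
      e = proj₂ (proj₂ (adjacent (suc n) h′))
    i≡j : i ≡ j
    i≡j = part-coordinate _ _ (sym (one-part (suc L₀) ≤-refl)) (sym e₁) eₙ

lemma4p1p1 : ExcludedMiddle 0ℓ →
    (d : Card) → TwoLe d → (X : Set) → (m : ℕ) → (T : Fin m → Tuple d X) →
    InjectiveFam T →
    (OneSided T × AlmostAcyclic T) ⇔ ConditionB T
lemma4p1p1 em d _ X m T _ = mk⇔ to from
  where
  to : OneSided T × AlmostAcyclic T → ConditionB T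
  to (os , aa) x0 = Labelling.good-partition em os aa x0
  from : ConditionB T → OneSided T × AlmostAcyclic T
  from cb = one-sided-from cb em , almost-acyclic-from cb
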